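{- Let $G$ be a finite simple graph that is hole-free and paraglider-free, and let $A$ be an induced subgraph of $G$ isomorphic to $\overline{C_6}$. For $i\in\{1,\dots,6\}$ let $A_i$ be the set of vertices $v\notin V(A)$ with exactly $i$ neighbors in $V(A)$, and for $v\notin V(A)$ let $N_A(v)=N(v)\cap V(A)$. Let $x,y$ be adjacent vertices such that either $x\in A_1$ and $y\in A_2\cup A_3$, or $x\in A_2$ and $y\in A_3$. Then $N_A(x)$ and $N_A(y)$ are comparable with respect to set inclusion.
   Context: A hole is an induced chordless cycle with at least five vertices. A paraglider is the graph on five vertices $u_1,u_2,w_1,w_2,p$ with edges $u_1u_2$, $u_iw_j$ for $i,j\in\{1,2\}$, $pw_1$, $pw_2$ (the complement of $P_2\cup P_3$). A graph is $H$-free if it has no induced subgraph isomorphic to $H$. $\overline{C_6}$ is the complement of the chordless 6-cycle. -}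

module Defs where

open import Data.Nat using (ℕ; zero; suc; _+_; _≤_; _≡ᵇ_)
open import Data.Fin using (Fin; toℕ; zero; suc)
open import Data.Bool using (Bool; true; false; _∧_; _∨_; not; if_then_else_)
open import Data.Product using (Σ; _×_)
open import Data.Sum using (_⊎_)
open import Relation.Nullary using (¬_)
open import Relation.Binary.PropositionalEquality using (_≡_)
open import Function.Definitions using (Injective)

record Graph : Set where
  field
    n     : ℕ
    adj   : Fin n → Fin n → Bool
    sym   : ∀ u v → adj u v ≡ adj v u
    irrfl : ∀ v → adj v v ≡ false
open Graph public

InducedCopy : (G : Graph) (k : ℕ) (hadj : Fin k → Fin k → Bool) → (Fin k → Fin (n G)) → Set
InducedCopy G k hadj f =
  Injective _≡_ _≡_ f × (∀ i j → adj G (f i) (f j) ≡ hadj i j)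

Free : (G : Graph) (k : ℕ) (hadj : Fin k → Fin k → Bool) → Set
Free G k hadj = ¬ (Σ (Fin k → Fin (n G)) λ f → InducedCopy G k hadj f)

cycleAdj : (k : ℕ) → Fin k → Fin k → Bool
cycleAdj k i j =
  (suc (toℕ i) ≡ᵇ toℕ j) ∨ (suc (toℕ j) ≡ᵇ toℕ i)
  ∨ ((toℕ i ≡ᵇ 0) ∧ (suc (toℕ j) ≡ᵇ k))
  ∨ ((toℕ j ≡ᵇ 0) ∧ (suc (toℕ i) ≡ᵇ k))

HoleFree : Graph → Set
HoleFree G = ∀ k → 5 ≤ k → Free G k (cycleAdj k)

-- Paraglider: vertices 0=u₁, 1=u₂, 2=w₁, 3=w₂, 4=p; edges u₁u₂, uᵢwⱼ, pw₁, pw₂.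
paragliderEdge : Fin 5 → Fin 5 → Bool
paragliderEdge zero (suc zero) = true
paragliderEdge zero (suc (suc zero)) = true
paragliderEdge zero (suc (suc (suc zero))) = true
paragliderEdge (suc zero) (suc (suc zero)) = true
paragliderEdge (suc zero) (suc (suc (suc zero))) = true
paragliderEdge (suc (suc zero)) (suc (suc (suc (suc zero)))) = true
paragliderEdge (suc (suc (suc zero))) (suc (suc (suc (suc zero)))) = true
paragliderEdge _ _ = false

paragliderAdj : Fin 5 → Fin 5 → Bool
paragliderAdj i j = paragliderEdge i j ∨ paragliderEdge j i

ParagliderFree : Graph → Set
ParagliderFree G = Free G 5 paragliderAdj

coC6Adj : Fin 6 → Fin 6 → Bool
coC6Adj i j = not (toℕ i ≡ᵇ toℕ j) ∧ not (cycleAdj 6 i j)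

count : ∀ {k} → (Fin k → Bool) → ℕ
count {zero} p = 0
count {suc k} p = (if p zero then 1 else 0) + count (λ i → p (suc i))

Outside : (G : Graph) → (Fin 6 → Fin (n G)) → Fin (n G) → Set
Outside G a v = ∀ j → ¬ (a j ≡ v)

InA : (G : Graph) → (Fin 6 → Fin (n G)) → ℕ → Fin (n G) → Set
InA G a i v = Outside G a v × count (λ j → adj G v (a j)) ≡ i

NA⊆ : (G : Graph) → (Fin 6 → Fin (n G)) → Fin (n G) → Fin (n G) → Set
NA⊆ G a x y = ∀ j → adj G x (a j) ≡ true → adj G y (a j) ≡ true

module Submission where

-- Everything relevant about the subgraph induced on V(A) ∪ {x, y} is
-- determined by the two neighbourhood traces N_A(x), N_A(y) ⊆ V(A), i.e. by
-- a pair of Boolean vectors of length 6.  There are only 2⁶ · 2⁶ such pairs,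
-- and for every pair that meets the degree hypothesis of the theorem but
-- whose traces are incomparable, one of finitely many listed certificates
-- exhibits five of the eight vertices inducing a C5 (a hole) or a
-- paraglider.  Since G contains neither, the traces must be comparable.

open import Defs
open import Data.Bool using (Bool; true; false; _∧_; _∨_; not; T)
open import Data.Bool.Properties using (T-∧; T-∨; T-≡)
import Data.Bool.Properties as Bool
open import Data.Empty using (⊥-elim)
open import Data.Fin using (Fin; zero; suc; #_)
import Data.Fin.Properties as Fin
open import Data.List using (List; []; _∷_)
open import Data.Nat using (ℕ; zero; suc; _+_; _≡ᵇ_)
open import Data.Nat.Properties using (≤-refl)
open import Data.Product using (Σ; _×_; _,_; proj₁; proj₂)
open import Data.Sum using (_⊎_; inj₁; inj₂; map₂)
open import Data.Vec using (Vec; []; _∷_; lookup; tabulate)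
open import Data.Vec.Properties using (lookup∘tabulate)
open import Function using (_∘_)
open import Function.Bundles using (Equivalence)
open import Function.Definitions using (Injective)
open import Relation.Binary.Definitions using (DecidableEquality)
open import Relation.Binary.PropositionalEquality
  using (_≡_; _≢_; refl; trans; cong; subst)
import Relation.Binary.PropositionalEquality as ≡
open import Relation.Nullary using (¬_; does; yes; no)
open import Relation.Nullary.Decidable using (⌊_⌋; toWitness; dec-true)
import Relation.Nullary.Decidable as Dec

open Equivalence using (to; from)


allFin : ∀ {k} → (Fin k → Bool) → Bool
allFin {zero}  p = true
allFin {suc k} p = p zero ∧ allFin (p ∘ suc)

allFin-sound : ∀ {k} (p : Fin k → Bool) → T (allFin p) → ∀ i → T (p i)
allFin-sound p holds zero    = proj₁ (to T-∧ holds)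
allFin-sound p holds (suc i) = allFin-sound (p ∘ suc) (proj₂ (to T-∧ holds)) i

anyList : {A : Set} → (A → Bool) → List A → Bool
anyList p []       = false
anyList p (w ∷ ws) = p w ∨ anyList p ws

anyList-sound : {A : Set} (p : A → Bool) (ws : List A) →
  T (anyList p ws) → Σ A (T ∘ p)
anyList-sound p (w ∷ ws) holds with to T-∨ holds
... | inj₁ here  = w , here
... | inj₂ there = anyList-sound p ws there

allBits : (k : ℕ) → (Vec Bool k → Bool) → Bool
allBits zero    P = P []
allBits (suc k) P = allBits k (P ∘ (true ∷_)) ∧ allBits k (P ∘ (false ∷_))

allBits-sound : ∀ k (P : Vec Bool k → Bool) → T (allBits k P) → ∀ v → T (P v)
allBits-sound zero    P holds []          = holds
allBits-sound (suc k) P holds (true ∷ v)  =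
  allBits-sound k (P ∘ (true ∷_)) (proj₁ (to T-∧ holds)) v
allBits-sound (suc k) P holds (false ∷ v) =
  allBits-sound k (P ∘ (false ∷_)) (proj₂ (to T-∧ holds)) v

implies : ∀ b {c} → T (not b ∨ c) → T b → T c
implies true c _ = c

count-cong : ∀ {k} {p q : Fin k → Bool} → (∀ j → p j ≡ q j) → count p ≡ count q
count-cong {zero}  p≗q = refl
count-cong {suc k} p≗q rewrite p≗q zero = cong (_ +_) (count-cong (p≗q ∘ suc))


module Certification {V : Set} (_≟V_ : DecidableEquality V)
                     (adjV : V → V → Bool) where

  separated : ∀ {k} → (Fin k → V) → Fin k → Fin k → Bool
  separated vs i j = ⌊ i Fin.≟ j ⌋ ∨ not (does (vs i ≟V vs j))

  matches : ∀ {k} → (Fin k → V) → (Fin k → Fin k → Bool) → Fin k → Fin k → Bool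
  matches vs h i j = ⌊ adjV (vs i) (vs j) Bool.≟ h i j ⌋

  isInducedPattern : ∀ {k} → (Fin k → V) → (Fin k → Fin k → Bool) → Bool
  isInducedPattern vs h =
    allFin λ i → allFin λ j → separated vs i j ∧ matches vs h i j

  certifiedCopy : (G : Graph) (g : V → Fin (n G)) → Injective _≡_ _≡_ g →
    (∀ u v → adj G (g u) (g v) ≡ adjV u v) →
    ∀ {k} (vs : Fin k → V) (h : Fin k → Fin k → Bool) →
    T (isInducedPattern vs h) → InducedCopy G k h (g ∘ vs)
  certifiedCopy G g g-inj g-adj vs h certified = injective , adjacency
    where
    entry : ∀ i j → T (separated vs i j) × T (matches vs h i j)
    entry i j = to (T-∧ {separated vs i j})
      (allFin-sound _ (allFin-sound (λ i → allFin λ j →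
        separated vs i j ∧ matches vs h i j) certified i) j)

    injective : Injective _≡_ _≡_ (g ∘ vs)
    injective {i} {j} gi≡gj
      with to (T-∨ {⌊ i Fin.≟ j ⌋}) (proj₁ (entry i j))
    ... | inj₁ i≡j   = toWitness i≡j
    ... | inj₂ vi≢vj =
      ⊥-elim (subst (T ∘ not) (dec-true (vs i ≟V vs j) (g-inj gi≡gj)) vi≢vj)

    adjacency : ∀ i j → adj G (g (vs i)) (g (vs j)) ≡ h i j
    adjacency i j = trans (g-adj (vs i) (vs j)) (toWitness (proj₂ (entry i j)))


data Local : Set where
  A    : Fin 6 → Local
  X Y  : Local

A-injective : ∀ {i j} → A i ≡ A j → i ≡ j
A-injective refl = refl

_≟L_ : DecidableEquality Local
A i ≟L A j = Dec.map′ (cong A) A-injective (i Fin.≟ j)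
A i ≟L X   = no λ ()
A i ≟L Y   = no λ ()
X   ≟L A j = no λ ()
X   ≟L X   = yes refl
X   ≟L Y   = no λ ()
Y   ≟L A j = no λ ()
Y   ≟L X   = no λ ()
Y   ≟L Y   = yes refl

localAdj : (nx ny : Vec Bool 6) → Local → Local → Bool
localAdj nx ny (A i) (A j) = coC6Adj i j
localAdj nx ny X     (A j) = lookup nx j
localAdj nx ny (A j) X     = lookup nx j
localAdj nx ny Y     (A j) = lookup ny j
localAdj nx ny (A j) Y     = lookup ny j
localAdj nx ny X     Y     = true
localAdj nx ny Y     X     = true
localAdj nx ny X     X     = false
localAdj nx ny Y     Y     = false

data Obstruction : Set where
  hole paraglider : Vec Local 5 → Obstruction

shape : Obstruction → Fin 5 → Fin 5 → Bool
shape (hole _)       = cycleAdj 5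
shape (paraglider _) = paragliderAdj

vertices : Obstruction → Fin 5 → Local
vertices (hole vs)       = lookup vs
vertices (paraglider vs) = lookup vs

occurs : (nx ny : Vec Bool 6) → Obstruction → Bool
occurs nx ny c =
  Certification.isInducedPattern _≟L_ (localAdj nx ny) (vertices c) (shape c)

obstructions : List Obstruction
obstructions =
    hole (A (# 1) ∷ A (# 4) ∷ Y ∷ X ∷ A (# 5) ∷ [])
  ∷ hole (A (# 1) ∷ A (# 3) ∷ Y ∷ A (# 2) ∷ A (# 4) ∷ [])
  ∷ hole (A (# 2) ∷ A (# 4) ∷ Y ∷ X ∷ A (# 5) ∷ [])
  ∷ paraglider (A (# 1) ∷ A (# 3) ∷ A (# 5) ∷ Y ∷ X ∷ [])
  ∷ hole (A (# 0) ∷ A (# 2) ∷ Y ∷ A (# 1) ∷ A (# 3) ∷ [])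
  ∷ hole (A (# 0) ∷ A (# 2) ∷ A (# 5) ∷ X ∷ Y ∷ [])
  ∷ hole (A (# 0) ∷ A (# 3) ∷ A (# 5) ∷ X ∷ Y ∷ [])
  ∷ hole (A (# 0) ∷ A (# 3) ∷ Y ∷ X ∷ A (# 4) ∷ [])
  ∷ hole (A (# 1) ∷ A (# 4) ∷ X ∷ Y ∷ A (# 5) ∷ [])
  ∷ hole (A (# 2) ∷ A (# 4) ∷ X ∷ Y ∷ A (# 5) ∷ [])
  ∷ hole (A (# 1) ∷ A (# 3) ∷ Y ∷ X ∷ A (# 4) ∷ [])
  ∷ paraglider (A (# 0) ∷ A (# 2) ∷ A (# 4) ∷ Y ∷ X ∷ [])
  ∷ hole (A (# 0) ∷ A (# 2) ∷ A (# 5) ∷ A (# 1) ∷ Y ∷ [])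
  ∷ paraglider (A (# 2) ∷ A (# 4) ∷ A (# 0) ∷ Y ∷ A (# 3) ∷ [])
  ∷ paraglider (A (# 1) ∷ A (# 5) ∷ A (# 3) ∷ Y ∷ A (# 0) ∷ [])
  ∷ hole (A (# 0) ∷ A (# 3) ∷ A (# 5) ∷ Y ∷ A (# 4) ∷ [])
  ∷ hole (A (# 0) ∷ A (# 2) ∷ Y ∷ X ∷ A (# 3) ∷ [])
  ∷ paraglider (A (# 1) ∷ A (# 5) ∷ A (# 3) ∷ Y ∷ X ∷ [])
  ∷ hole (A (# 0) ∷ A (# 3) ∷ X ∷ Y ∷ A (# 4) ∷ [])
  ∷ hole (A (# 0) ∷ A (# 4) ∷ A (# 1) ∷ A (# 5) ∷ Y ∷ [])
  ∷ hole (A (# 1) ∷ A (# 3) ∷ X ∷ Y ∷ A (# 4) ∷ [])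
  ∷ hole (A (# 2) ∷ A (# 5) ∷ A (# 3) ∷ X ∷ Y ∷ [])
  ∷ paraglider (A (# 1) ∷ A (# 3) ∷ A (# 5) ∷ Y ∷ A (# 2) ∷ [])
  ∷ paraglider (A (# 0) ∷ A (# 2) ∷ A (# 4) ∷ Y ∷ A (# 1) ∷ [])
  ∷ paraglider (A (# 0) ∷ A (# 4) ∷ A (# 2) ∷ Y ∷ A (# 5) ∷ [])
  ∷ hole (A (# 0) ∷ A (# 2) ∷ X ∷ Y ∷ A (# 3) ∷ [])
  ∷ hole (A (# 1) ∷ A (# 4) ∷ A (# 2) ∷ X ∷ Y ∷ [])
  ∷ hole (A (# 1) ∷ A (# 5) ∷ A (# 2) ∷ X ∷ Y ∷ [])
  ∷ paraglider (A (# 0) ∷ A (# 4) ∷ A (# 2) ∷ Y ∷ X ∷ [])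
  ∷ hole (A (# 2) ∷ A (# 5) ∷ A (# 3) ∷ Y ∷ X ∷ [])
  ∷ paraglider (A (# 3) ∷ A (# 5) ∷ A (# 1) ∷ Y ∷ A (# 4) ∷ [])
  ∷ paraglider (A (# 3) ∷ A (# 5) ∷ A (# 1) ∷ Y ∷ X ∷ [])
  ∷ hole (A (# 2) ∷ A (# 4) ∷ Y ∷ A (# 3) ∷ A (# 5) ∷ [])
  ∷ hole (A (# 1) ∷ A (# 4) ∷ A (# 2) ∷ Y ∷ X ∷ [])
  ∷ hole (A (# 1) ∷ A (# 5) ∷ A (# 2) ∷ Y ∷ X ∷ [])
  ∷ hole (A (# 0) ∷ A (# 3) ∷ A (# 1) ∷ X ∷ Y ∷ [])
  ∷ hole (A (# 0) ∷ A (# 4) ∷ A (# 1) ∷ X ∷ Y ∷ [])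
  ∷ hole (A (# 0) ∷ A (# 2) ∷ A (# 5) ∷ Y ∷ X ∷ [])
  ∷ hole (A (# 0) ∷ A (# 3) ∷ A (# 5) ∷ Y ∷ X ∷ [])
  ∷ paraglider (A (# 2) ∷ A (# 4) ∷ A (# 0) ∷ Y ∷ X ∷ [])
  ∷ hole (A (# 0) ∷ A (# 3) ∷ A (# 1) ∷ Y ∷ X ∷ [])
  ∷ hole (A (# 0) ∷ A (# 4) ∷ A (# 1) ∷ Y ∷ X ∷ [])
  ∷ []

degrees : (nx ny : Vec Bool 6) → Bool
degrees nx ny =
  ((size nx ≡ᵇ 1) ∧ ((size ny ≡ᵇ 2) ∨ (size ny ≡ᵇ 3)))
  ∨ ((size nx ≡ᵇ 2) ∧ (size ny ≡ᵇ 3))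
  where
  size : Vec Bool 6 → ℕ
  size = count ∘ lookup

_⊆ᵇ_ : Vec Bool 6 → Vec Bool 6 → Bool
nx ⊆ᵇ ny = allFin λ j → not (lookup nx j) ∨ lookup ny j

⊆ᵇ-sound : ∀ {nx ny} → T (nx ⊆ᵇ ny) → ∀ j → T (lookup nx j) → T (lookup ny j)
⊆ᵇ-sound {nx} {ny} incl j =
  implies (lookup nx j) (allFin-sound (λ j → not (lookup nx j) ∨ lookup ny j) incl j)

-- The finite heart of the argument, verified by evaluation over all pairs
-- of traces: under the degree hypothesis the traces are comparable or some
-- listed obstruction occurs.
trace-dichotomy : ∀ nx ny → T (degrees nx ny) →
  T (nx ⊆ᵇ ny) ⊎ T (ny ⊆ᵇ nx) ⊎ T (anyList (occurs nx ny) obstructions)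
trace-dichotomy nx ny deg =
  map₂ (to (T-∨ {ny ⊆ᵇ nx})) (to (T-∨ {nx ⊆ᵇ ny}) comparableOrObstructed)
  where
  verdict : Vec Bool 6 → Vec Bool 6 → Bool
  verdict nx ny = not (degrees nx ny)
    ∨ nx ⊆ᵇ ny ∨ ny ⊆ᵇ nx ∨ anyList (occurs nx ny) obstructions

  everyPair : T (allBits 6 λ nx → allBits 6 λ ny → verdict nx ny)
  everyPair = _

  comparableOrObstructed :
    T (nx ⊆ᵇ ny ∨ ny ⊆ᵇ nx ∨ anyList (occurs nx ny) obstructions)
  comparableOrObstructed =
    implies (degrees nx ny) (allBits-sound 6 (verdict nx)
              (allBits-sound 6 (λ nx → allBits 6 (verdict nx)) everyPair nx) ny) deg

obstruction-excluded : (G : Graph) → HoleFree G → ParagliderFree G →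
  ∀ c {f : Fin 5 → Fin (n G)} → ¬ InducedCopy G 5 (shape c) f
obstruction-excluded G hole-free para-free (hole _)       copy =
  hole-free 5 ≤-refl (_ , copy)
obstruction-excluded G hole-free para-free (paraglider _) copy =
  para-free (_ , copy)


DegreeHypothesis : (G : Graph) → (Fin 6 → Fin (n G)) → Fin (n G) → Fin (n G) → Set
DegreeHypothesis G a x y =
  (InA G a 1 x × (InA G a 2 y ⊎ InA G a 3 y)) ⊎ (InA G a 2 x × InA G a 3 y)

outside-x : ∀ {G a x y} → DegreeHypothesis G a x y → Outside G a x
outside-x (inj₁ ((out , _) , _)) = out
outside-x (inj₂ ((out , _) , _)) = out

outside-y : ∀ {G a x y} → DegreeHypothesis G a x y → Outside G a y
outside-y (inj₁ (_ , inj₁ (out , _))) = out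
outside-y (inj₁ (_ , inj₂ (out , _))) = out
outside-y (inj₂ (_ , (out , _)))      = out

module Realisation (G : Graph) (a : Fin 6 → Fin (n G))
                   (a-copy : InducedCopy G 6 coC6Adj a)
                   (x y : Fin (n G)) (x~y : adj G x y ≡ true)
                   (x-out : Outside G a x) (y-out : Outside G a y) where

  trace : Fin (n G) → Vec Bool 6
  trace v = tabulate λ j → adj G v (a j)

  trace-lookup : ∀ v j → lookup (trace v) j ≡ adj G v (a j)
  trace-lookup v j = lookup∘tabulate (λ j → adj G v (a j)) j

  embed : Local → Fin (n G)
  embed (A i) = a i
  embed X     = x
  embed Y     = y

  x≢y : x ≢ y
  x≢y refl with trans (≡.sym (irrfl G x)) x~y
  ... | ()

  embed-injective : Injective _≡_ _≡_ embed
  embed-injective {A i} {A j} e = cong A (proj₁ a-copy e)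
  embed-injective {A i} {X}   e = ⊥-elim (x-out i e)
  embed-injective {A i} {Y}   e = ⊥-elim (y-out i e)
  embed-injective {X}   {A j} e = ⊥-elim (x-out j (≡.sym e))
  embed-injective {Y}   {A j} e = ⊥-elim (y-out j (≡.sym e))
  embed-injective {X}   {X}   e = refl
  embed-injective {Y}   {Y}   e = refl
  embed-injective {X}   {Y}   e = ⊥-elim (x≢y e)
  embed-injective {Y}   {X}   e = ⊥-elim (x≢y (≡.sym e))

  embed-adj : ∀ u v → adj G (embed u) (embed v) ≡ localAdj (trace x) (trace y) u v
  embed-adj (A i) (A j) = proj₂ a-copy i j
  embed-adj X     (A j) = ≡.sym (trace-lookup x j)
  embed-adj Y     (A j) = ≡.sym (trace-lookup y j)
  embed-adj (A j) X     = trans (sym G (a j) x) (≡.sym (trace-lookup x j))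
  embed-adj (A j) Y     = trans (sym G (a j) y) (≡.sym (trace-lookup y j))
  embed-adj X     Y     = x~y
  embed-adj Y     X     = trans (sym G y x) x~y
  embed-adj X     X     = irrfl G x
  embed-adj Y     Y     = irrfl G y

  no-obstruction : HoleFree G → ParagliderFree G →
    ¬ T (anyList (occurs (trace x) (trace y)) obstructions)
  no-obstruction hole-free para-free found
    with anyList-sound _ obstructions found
  ... | c , occurring = obstruction-excluded G hole-free para-free c
    (Certification.certifiedCopy _≟L_ (localAdj (trace x) (trace y))
       G embed embed-injective embed-adj (vertices c) (shape c) occurring)

  trace-⊆ : ∀ {u v} → T (trace u ⊆ᵇ trace v) → NA⊆ G a u v
  trace-⊆ {u} {v} incl j u~aj = trans (≡.sym (trace-lookup v j))
    (to T-≡ (⊆ᵇ-sound {trace u} {trace v} incl j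
      (from T-≡ (trans (trace-lookup u j) u~aj))))

  degrees-hold : DegreeHypothesis G a x y → T (degrees (trace x) (trace y))
  degrees-hold hyp
    rewrite count-cong (trace-lookup x) | count-cong (trace-lookup y) with hyp
  ... | inj₁ ((_ , dx) , inj₁ (_ , dy)) rewrite dx | dy = _
  ... | inj₁ ((_ , dx) , inj₂ (_ , dy)) rewrite dx | dy = _
  ... | inj₂ ((_ , dx) , (_ , dy))      rewrite dx | dy = _


proposition4 : (G : Graph) → HoleFree G → ParagliderFree G →
    (a : Fin 6 → Fin (n G)) → InducedCopy G 6 coC6Adj a →
    (x y : Fin (n G)) → adj G x y ≡ true →
    ((InA G a 1 x × (InA G a 2 y ⊎ InA G a 3 y)) ⊎ (InA G a 2 x × InA G a 3 y)) →
    NA⊆ G a x y ⊎ NA⊆ G a y x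
proposition4 G hole-free para-free a a-copy x y x~y hyp =
  comparable (trace-dichotomy (trace x) (trace y) (degrees-hold hyp))
  where
  open Realisation G a a-copy x y x~y (outside-x {G} {a} hyp) (outside-y {G} {a} hyp)

  comparable : T (trace x ⊆ᵇ trace y) ⊎ T (trace y ⊆ᵇ trace x)
                 ⊎ T (anyList (occurs (trace x) (trace y)) obstructions) →
               NA⊆ G a x y ⊎ NA⊆ G a y x
  comparable (inj₁ x⊆y)        = inj₁ (trace-⊆ x⊆y)
  comparable (inj₂ (inj₁ y⊆x)) = inj₂ (trace-⊆ y⊆x)
  comparable (inj₂ (inj₂ obs)) = ⊥-elim (no-obstruction hole-free para-free obs)
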